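{- Let $\mathcal{B}=\{B_1,\dots,B_m\}$ be a partition of $n$ jobs with processing times $\mathbf{p}$ into $m$ bags, and let $\mathcal{B}^*$ be an optimal partition of the jobs into $m$ sets for $m$ identical unit-speed machines (so $\max_{B'\in\mathcal{B}^*}p(B')=opt(\mathbf{p},m)$). If $\frac{\max_{B\in\mathcal{B}}p(B)}{\max_{B'\in\mathcal{B}^*}p(B')}\le\theta$, then $\mathcal{B}$ is a $\max\{\theta,2\}$-robust partition: for every $m_0\in\{1,\dots,m\}$, the bags of $\mathcal{B}$ can be assigned (each bag whole) to $m_0$ identical unit-speed machines with makespan at most $\max\{\theta,2\}\cdot opt(\mathbf{p},m_0)$.
   Context: $p(B)=\sum_{j\in B}p_j$ with $p_j\ge0$. The makespan of an assignment to identical unit-speed machines is the maximum total processing time on a machine. $opt(\mathbf{p},k)$ is the minimum makespan of scheduling the individual jobs on $k$ identical unit-speed machines.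
   Formalization: The processing times $p_j$ and the ratio bound θ are rational. -}

module Defs where

open import Data.Nat using (ℕ; zero; suc)
open import Data.Fin using (Fin; zero; suc; _≟_)
open import Data.Bool using (if_then_else_)
open import Relation.Nullary.Decidable using (⌊_⌋)
open import Data.Rational using (ℚ; 0ℚ; 1ℚ; _+_; _⊔_)

sumFin : ∀ k → (Fin k → ℚ) → ℚ
sumFin zero    f = 0ℚ
sumFin (suc k) f = f zero + sumFin k (λ i → f (suc i))

-- Maximum of f over Fin k (0 for k = 0; all values used are nonnegative loads).
maxFin : ∀ k → (Fin k → ℚ) → ℚ
maxFin zero    f = 0ℚ
maxFin (suc k) f = f zero ⊔ maxFin k (λ i → f (suc i))

-- An assignment of n jobs to k sets (bags / machines) is a map Fin n → Fin k.
-- p(B) for the set B = σ⁻¹(i):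
load : ∀ {n k} → (Fin n → ℚ) → (Fin n → Fin k) → Fin k → ℚ
load {n} p σ i = sumFin n (λ j → if ⌊ σ j ≟ i ⌋ then p j else 0ℚ)

makespan : ∀ {n k} → (Fin n → ℚ) → (Fin n → Fin k) → ℚ
makespan {n} {k} p σ = maxFin k (load p σ)

IsOpt : ∀ {n} → (Fin n → ℚ) → (k : ℕ) → ℚ → Set
IsOpt {n} p k o = (Σ (Fin n → Fin k) λ σ → makespan p σ ≡ o)
                × (∀ (σ : Fin n → Fin k) → o ≤ makespan p σ)
  where
    open import Data.Product using (Σ; _×_)
    open import Relation.Binary.PropositionalEquality using (_≡_)
    open import Data.Rational using (_≤_)

two : ℚ
two = 1ℚ + 1ℚ

{-# OPTIONS --safe #-}
-- Let o = opt(p, m₀). A schedule on m₀ ≤ m machines is also one on m machines, so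
-- opt(p, m) ≤ o: every bag has size at most θ·o, and all bags together at most m₀·o.
-- Hence, while not all bags are placed, some machine has load at most o. First place the
-- big bags (size > o), each on such a machine: it carries no big bag yet, so it is empty
-- and its load becomes a single bag. Then place the small bags (size ≤ o), each on such a
-- machine, which keeps every load at most o + o.
module Submission where

open import Defs
open import Data.Nat using (ℕ; zero; suc) renaming (_≤_ to _≤ℕ_)
open import Data.Fin using (Fin; zero; suc; _≟_; inject≤)
open import Data.Fin.Properties using (any?; suc-injective; inject≤-injective)
open import Data.Bool using (Bool; true; false; if_then_else_)
open import Data.Product using (Σ; _×_; _,_; ∃)
open import Data.Empty using (⊥-elim)
open import Data.Sum using (_⊎_; inj₁; inj₂)
open import Data.Vec.Functional using (_∷_)
open import Function using (_∘_)
open import Function.Definitions using (Injective)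
open import Relation.Nullary using (yes; no; contradiction)
open import Relation.Nullary.Decidable using (⌊_⌋; from-yes)
open import Relation.Binary.PropositionalEquality
open import Data.Rational using (ℚ; 0ℚ; 1ℚ; _+_; _*_; _⊔_; _≤_; _<_; _≤?_; _<?_; nonNegative)
open import Data.Rational.Properties hiding (_≟_)
open import Algebra.Properties.CommutativeMonoid.Sum +-0-commutativeMonoid
  using (sum; sum-cong-≗; ∑-distrib-+; ∑-comm; sum-replicate-zero)

p≤p+q : ∀ p {q} → 0ℚ ≤ q → p ≤ p + q
p≤p+q p {q} 0≤q = subst (_≤ p + q) (+-identityʳ p) (+-monoʳ-≤ p 0≤q)

sumFin≡sum : ∀ k (f : Fin k → ℚ) → sumFin k f ≡ sum f
sumFin≡sum zero    f = refl
sumFin≡sum (suc k) f = cong (f zero +_) (sumFin≡sum k (f ∘ suc))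

sumFin-cong : ∀ k {f g : Fin k → ℚ} → (∀ i → f i ≡ g i) → sumFin k f ≡ sumFin k g
sumFin-cong zero    f≡g = refl
sumFin-cong (suc k) f≡g = cong₂ _+_ (f≡g zero) (sumFin-cong k (f≡g ∘ suc))

sumFin-zero : ∀ k → sumFin k (λ _ → 0ℚ) ≡ 0ℚ
sumFin-zero k = trans (sumFin≡sum k _) (sum-replicate-zero k)

sumFin-distrib-+ : ∀ k (f g : Fin k → ℚ) →
                   sumFin k (λ i → f i + g i) ≡ sumFin k f + sumFin k g
sumFin-distrib-+ k f g = begin
  sumFin k (λ i → f i + g i) ≡⟨ sumFin≡sum k _ ⟩
  sum (λ i → f i + g i)      ≡⟨ ∑-distrib-+ f g ⟩
  sum f + sum g              ≡⟨ cong₂ _+_ (sumFin≡sum k f) (sumFin≡sum k g) ⟨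
  sumFin k f + sumFin k g    ∎
  where open ≡-Reasoning

sumFin-comm : ∀ k l (f : Fin k → Fin l → ℚ) →
              sumFin k (λ i → sumFin l (f i)) ≡ sumFin l (λ j → sumFin k (λ i → f i j))
sumFin-comm k l f = begin
  sumFin k (λ i → sumFin l (f i))          ≡⟨ sumFin≡sum k _ ⟩
  sum (λ i → sumFin l (f i))               ≡⟨ sum-cong-≗ (λ i → sumFin≡sum l (f i)) ⟩
  sum (λ i → sum (f i))                    ≡⟨ ∑-comm f ⟩
  sum (λ j → sum (λ i → f i j))            ≡⟨ sum-cong-≗ (λ j → sumFin≡sum k (λ i → f i j)) ⟨
  sum (λ j → sumFin k (λ i → f i j))       ≡⟨ sumFin≡sum l _ ⟨
  sumFin l (λ j → sumFin k (λ i → f i j))  ∎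
  where open ≡-Reasoning

sumFin-mono-≤ : ∀ k {f g : Fin k → ℚ} → (∀ i → f i ≤ g i) → sumFin k f ≤ sumFin k g
sumFin-mono-≤ zero    f≤g = ≤-refl
sumFin-mono-≤ (suc k) f≤g = +-mono-≤ (f≤g zero) (sumFin-mono-≤ k (f≤g ∘ suc))

sumFin-mono-< : ∀ k {f g : Fin (suc k) → ℚ} → (∀ i → f i < g i) →
                sumFin (suc k) f < sumFin (suc k) g
sumFin-mono-< k f<g = +-mono-<-≤ (f<g zero) (sumFin-mono-≤ k (<⇒≤ ∘ f<g ∘ suc))

sumFin-nonneg : ∀ k {f : Fin k → ℚ} → (∀ i → 0ℚ ≤ f i) → 0ℚ ≤ sumFin k f
sumFin-nonneg k 0≤f = subst (_≤ sumFin k _) (sumFin-zero k) (sumFin-mono-≤ k 0≤f)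

sumFin-≤⇒∃-≤ : ∀ k (f g : Fin (suc k) → ℚ) → sumFin (suc k) f ≤ sumFin (suc k) g →
               ∃ λ i → f i ≤ g i
sumFin-≤⇒∃-≤ k f g ∑f≤∑g with any? (λ i → f i ≤? g i)
... | yes f≤g = f≤g
... | no ∄f≤g = ⊥-elim (<-irrefl refl (<-≤-trans ∑g<∑f ∑f≤∑g))
  where
  ∑g<∑f : sumFin (suc k) g < sumFin (suc k) f
  ∑g<∑f = sumFin-mono-< k (λ i → ≰⇒> (∄f≤g ∘ (i ,_)))

f≤maxFin : ∀ k (f : Fin k → ℚ) i → f i ≤ maxFin k f
f≤maxFin (suc k) f zero    = p≤p⊔q (f zero) _
f≤maxFin (suc k) f (suc i) = ≤-trans (f≤maxFin k (f ∘ suc) i) (p≤q⊔p (f zero) _)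

maxFin-≤ : ∀ k {f : Fin k → ℚ} {C} → 0ℚ ≤ C → (∀ i → f i ≤ C) → maxFin k f ≤ C
maxFin-≤ zero    0≤C f≤C = 0≤C
maxFin-≤ (suc k) 0≤C f≤C = ⊔-lub (f≤C zero) (maxFin-≤ k 0≤C (f≤C ∘ suc))

maxFin-cong : ∀ k {f g : Fin k → ℚ} → (∀ i → f i ≡ g i) → maxFin k f ≡ maxFin k g
maxFin-cong zero    f≡g = refl
maxFin-cong (suc k) f≡g = cong₂ _⊔_ (f≡g zero) (maxFin-cong k (f≡g ∘ suc))

maxFin-nonneg : ∀ k (f : Fin k → ℚ) → 0ℚ ≤ maxFin k f
maxFin-nonneg zero    f = ≤-refl
maxFin-nonneg (suc k) f = ≤-trans (maxFin-nonneg k (f ∘ suc)) (p≤q⊔p (f zero) _)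

-- load p σ c unfolds to sumFin n (λ j → δ (σ j) c (p j)).
δ : ∀ {k} → Fin k → Fin k → ℚ → ℚ
δ a c x = if ⌊ a ≟ c ⌋ then x else 0ℚ

δ-refl : ∀ {k} (a : Fin k) x → δ a a x ≡ x
δ-refl a x with a ≟ a
... | yes _   = refl
... | no a≢a = contradiction refl a≢a

δ-≢ : ∀ {k} {a c : Fin k} x → a ≢ c → δ a c x ≡ 0ℚ
δ-≢ {a = a} {c} x a≢c with a ≟ c
... | yes a≡c = contradiction a≡c a≢c
... | no _    = refl

δ-zero : ∀ {k} (a c : Fin k) → δ a c 0ℚ ≡ 0ℚ
δ-zero a c with ⌊ a ≟ c ⌋
... | true  = refl
... | false = refl

δ-nonneg : ∀ {k} (a c : Fin k) {x} → 0ℚ ≤ x → 0ℚ ≤ δ a c x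
δ-nonneg a c 0≤x with ⌊ a ≟ c ⌋
... | true  = 0≤x
... | false = ≤-refl

δ-swap : ∀ {k l} (a c : Fin k) (b d : Fin l) x → δ a c (δ b d x) ≡ δ b d (δ a c x)
δ-swap a c b d x with ⌊ a ≟ c ⌋ | ⌊ b ≟ d ⌋
... | true  | true  = refl
... | true  | false = refl
... | false | true  = refl
... | false | false = refl

δ-injective : ∀ {k l} {g : Fin k → Fin l} → Injective _≡_ _≡_ g → ∀ a c x → δ (g a) (g c) x ≡ δ a c x
δ-injective g-inj a c x with a ≟ c
... | yes refl = δ-refl _ x
... | no a≢c   = δ-≢ x (a≢c ∘ g-inj)

δ-sumFin : ∀ {l} k (a c : Fin l) (f : Fin k → ℚ) → δ a c (sumFin k f) ≡ sumFin k (λ j → δ a c (f j))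
δ-sumFin k a c f with ⌊ a ≟ c ⌋
... | true  = refl
... | false = sym (sumFin-zero k)

sumFin-δ : ∀ k (a : Fin k) (f : Fin k → ℚ) → sumFin k (λ c → δ a c (f c)) ≡ f a
sumFin-δ (suc k) zero    f = trans (cong (f zero +_) (sumFin-zero k)) (+-identityʳ (f zero))
sumFin-δ (suc k) (suc a) f = begin
  0ℚ + sumFin k (λ c → δ (suc a) (suc c) (f (suc c))) ≡⟨ +-identityˡ _ ⟩
  sumFin k (λ c → δ (suc a) (suc c) (f (suc c)))      ≡⟨ sumFin-cong k (λ c → δ-injective suc-injective a c _) ⟩
  sumFin k (λ c → δ a c (f (suc c)))                  ≡⟨ sumFin-δ k a (f ∘ suc) ⟩
  f (suc a)                                           ∎
  where open ≡-Reasoning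

load-nonneg : ∀ {n k} {p : Fin n → ℚ} → (∀ j → 0ℚ ≤ p j) → (σ : Fin n → Fin k) → ∀ c → 0ℚ ≤ load p σ c
load-nonneg {n} 0≤p σ c = sumFin-nonneg n (λ j → δ-nonneg (σ j) c (0≤p j))

sumFin-load : ∀ {n k} (p : Fin n → ℚ) (σ : Fin n → Fin k) → sumFin k (load p σ) ≡ sumFin n p
sumFin-load {n} {k} p σ =
  trans (sumFin-comm k n _) (sumFin-cong n (λ j → sumFin-δ k (σ j) (λ _ → p j)))

load-∘ : ∀ {n k l} (p : Fin n → ℚ) (σ : Fin n → Fin k) (τ : Fin k → Fin l) c →
         load p (τ ∘ σ) c ≡ load (load p σ) τ c
load-∘ {n} {k} p σ τ c = sym (begin
  sumFin k (λ i → δ (τ i) c (sumFin n (λ j → δ (σ j) i (p j))))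
    ≡⟨ sumFin-cong k (λ i → δ-sumFin n (τ i) c _) ⟩
  sumFin k (λ i → sumFin n (λ j → δ (τ i) c (δ (σ j) i (p j))))
    ≡⟨ sumFin-comm k n _ ⟩
  sumFin n (λ j → sumFin k (λ i → δ (τ i) c (δ (σ j) i (p j))))
    ≡⟨ sumFin-cong n (λ j → sumFin-cong k (λ i → δ-swap (τ i) c (σ j) i (p j))) ⟩
  sumFin n (λ j → sumFin k (λ i → δ (σ j) i (δ (τ i) c (p j))))
    ≡⟨ sumFin-cong n (λ j → sumFin-δ k (σ j) (λ i → δ (τ i) c (p j))) ⟩
  sumFin n (λ j → δ (τ (σ j)) c (p j)) ∎)
  where open ≡-Reasoning

makespan-∘ : ∀ {n k l} (p : Fin n → ℚ) (σ : Fin n → Fin k) (τ : Fin k → Fin l) →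
             makespan p (τ ∘ σ) ≡ makespan (load p σ) τ
makespan-∘ p σ τ = maxFin-cong _ (load-∘ p σ τ)

makespan-∘-injective : ∀ {n k l} (p : Fin n → ℚ) (σ : Fin n → Fin k) {g : Fin k → Fin l} →
                       Injective _≡_ _≡_ g → makespan p (g ∘ σ) ≤ makespan p σ
makespan-∘-injective {n} {k} {l} p σ {g} g-inj =
  maxFin-≤ l (maxFin-nonneg k (load p σ)) load≤makespan
  where
  load≤makespan : ∀ c → load p (g ∘ σ) c ≤ makespan p σ
  load≤makespan c with any? (λ a → g a ≟ c)
  ... | yes (a , refl) = ≤-trans
          (≤-reflexive (sumFin-cong n (λ j → δ-injective g-inj (σ j) a (p j))))
          (f≤maxFin k (load p σ) a)
  ... | no c∉img = ≤-trans
          (≤-reflexive (trans (sumFin-cong n (λ j → δ-≢ (p j) (c∉img ∘ (σ j ,_)))) (sumFin-zero n)))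
          (maxFin-nonneg k (load p σ))

sumFin≤sumFin-makespan : ∀ {n k} (p : Fin n → ℚ) (σ : Fin n → Fin k) →
                         sumFin n p ≤ sumFin k (λ _ → makespan p σ)
sumFin≤sumFin-makespan {n} {k} p σ = begin
  sumFin n p                      ≡⟨ sumFin-load p σ ⟨
  sumFin k (load p σ)             ≤⟨ sumFin-mono-≤ k (f≤maxFin k (load p σ)) ⟩
  sumFin k (λ _ → makespan p σ)   ∎
  where open ≤-Reasoning

load-if : ∀ {n k} (β : Fin n → Bool) (p : Fin n → ℚ) (σ τ : Fin n → Fin k) c →
          load p (λ j → if β j then σ j else τ j) c
            ≡ load (λ j → if β j then p j else 0ℚ) σ c + load (λ j → if β j then 0ℚ else p j) τ c
load-if {n} β p σ τ c = trans (sumFin-cong n split) (sumFin-distrib-+ n _ _)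
  where
  split : ∀ j → δ (if β j then σ j else τ j) c (p j)
              ≡ δ (σ j) c (if β j then p j else 0ℚ) + δ (τ j) c (if β j then 0ℚ else p j)
  split j with β j
  ... | true  = sym (trans (cong (δ (σ j) c (p j) +_) (δ-zero (τ j) c)) (+-identityʳ _))
  ... | false = sym (trans (cong (_+ δ (τ j) c (p j)) (δ-zero (σ j) c)) (+-identityˡ _))

two*p≡p+p : ∀ p → two * p ≡ p + p
two*p≡p+p p = trans (*-distribʳ-+ p 1ℚ 1ℚ) (cong₂ _+_ (*-identityˡ p) (*-identityˡ p))

p+p≤[q⊔two]*p : ∀ q {p} → 0ℚ ≤ p → p + p ≤ (q ⊔ two) * p
p+p≤[q⊔two]*p q {p} 0≤p = begin
  p + p          ≡⟨ two*p≡p+p p ⟨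
  two * p        ≤⟨ *-monoʳ-≤-nonNeg p {{nonNegative 0≤p}} (p≤q⊔p q two) ⟩
  (q ⊔ two) * p  ∎
  where open ≤-Reasoning

q*p≤[q⊔two]*r : ∀ q {p r} → 0ℚ ≤ p → p ≤ r → q * p ≤ (q ⊔ two) * r
q*p≤[q⊔two]*r q {p} {r} 0≤p p≤r = begin
  q * p          ≤⟨ *-monoʳ-≤-nonNeg p {{nonNegative 0≤p}} (p≤p⊔q q two) ⟩
  (q ⊔ two) * p  ≤⟨ *-monoˡ-≤-nonNeg (q ⊔ two) {{nonNegative 0≤q⊔two}} p≤r ⟩
  (q ⊔ two) * r  ∎
  where
  open ≤-Reasoning
  0≤q⊔two : 0ℚ ≤ q ⊔ two
  0≤q⊔two = ≤-trans (from-yes (0ℚ ≤? two)) (p≤q⊔p q two)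

-- Throughout, sumFin (suc M) (λ _ → o) stands for (M + 1)·o.
module ListScheduling (M : ℕ) (o : ℚ) (P Q : ℚ → Set)
  (place : ∀ {ℓ x} → P ℓ → Q x → ℓ ≤ o → P (ℓ + x)) where

  K : ℕ
  K = suc M

  addAt : Fin K → ℚ → (Fin K → ℚ) → Fin K → ℚ
  addAt c₀ x L c = L c + δ c₀ c x

  P-addAt : ∀ {L c₀ x} → (∀ c → P (L c)) → Q x → L c₀ ≤ o → ∀ c → P (addAt c₀ x L c)
  P-addAt {L} {c₀} PL Qx Lc₀≤o c with c₀ ≟ c
  ... | yes refl = place (PL c) Qx Lc₀≤o
  ... | no _     = subst P (sym (+-identityʳ (L c))) (PL c)

  sumFin-addAt : ∀ c₀ x L → sumFin K (addAt c₀ x L) ≡ sumFin K L + x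
  sumFin-addAt c₀ x L =
    trans (sumFin-distrib-+ K L (λ c → δ c₀ c x)) (cong (sumFin K L +_) (sumFin-δ K c₀ (λ _ → x)))

  schedule : ∀ m (w : Fin m → ℚ) (L : Fin K → ℚ) →
             (∀ i → 0ℚ ≤ w i) → (∀ i → Q (w i)) → (∀ c → P (L c)) →
             sumFin K L + sumFin m w ≤ sumFin K (λ _ → o) →
             Σ (Fin m → Fin K) λ τ → ∀ c → P (L c + load w τ c)
  schedule zero    w L 0≤w Qw PL total = (λ ()) , λ c → subst P (sym (+-identityʳ (L c))) (PL c)
  schedule (suc m) w L 0≤w Qw PL total
    with sumFin-≤⇒∃-≤ M L (λ _ → o) (≤-trans (p≤p+q _ (sumFin-nonneg (suc m) 0≤w)) total)
  ... | c₀ , Lc₀≤o =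
    let τ , Pτ = schedule m (w ∘ suc) (addAt c₀ (w zero) L) (0≤w ∘ suc) (Qw ∘ suc)
                   (P-addAt PL (Qw zero) Lc₀≤o) total′
    in (c₀ ∷ τ) , λ c → subst P (+-assoc (L c) _ _) (Pτ c)
    where
    total′ : sumFin K (addAt c₀ (w zero) L) + sumFin m (w ∘ suc) ≤ sumFin K (λ _ → o)
    total′ = ≤-trans (≤-reflexive (trans (cong (_+ sumFin m (w ∘ suc)) (sumFin-addAt c₀ (w zero) L))
                                         (+-assoc (sumFin K L) (w zero) _))) total

EmptyOrBig : ℚ → ℚ → ℚ → Set
EmptyOrBig o C x = x ≡ 0ℚ ⊎ (o < x × x ≤ C)

if-split : ∀ β x → (if β then x else 0ℚ) + (if β then 0ℚ else x) ≡ x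
if-split true  x = +-identityʳ x
if-split false x = +-identityˡ x

∃-makespan-≤ : ∀ M {m} {o C : ℚ} (b : Fin m → ℚ) → 0ℚ ≤ o → o + o ≤ C →
             (∀ i → 0ℚ ≤ b i) → (∀ i → b i ≤ C) → sumFin m b ≤ sumFin (suc M) (λ _ → o) →
             Σ (Fin m → Fin (suc M)) λ τ → makespan b τ ≤ C
∃-makespan-≤ M {m} {o} {C} b 0≤o o+o≤C 0≤b b≤C total =
  let τ₁ , EmptyOrBig-τ₁ = Phase₁.schedule m big (λ _ → 0ℚ) 0≤big big-EmptyOrBig (λ _ → inj₁ refl) total₁
      τ₂ , ≤C-τ₂ = Phase₂.schedule m small (λ c → 0ℚ + load big τ₁ c) 0≤small small≤o
                     (EmptyOrBig⇒≤C ∘ EmptyOrBig-τ₁) (total₂ τ₁)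
  in (λ i → if isBig i then τ₁ i else τ₂ i) ,
     maxFin-≤ K 0≤C (λ c → subst (_≤ C) (sym (load-merge τ₁ τ₂ c)) (≤C-τ₂ c))
  where
  K : ℕ
  K = suc M

  -- Both phases run over all m bags, the bags of the other phase having weight 0.
  isBig : Fin m → Bool
  isBig i = ⌊ o <? b i ⌋

  big small : Fin m → ℚ
  big   i = if isBig i then b i else 0ℚ
  small i = if isBig i then 0ℚ else b i

  0≤C : 0ℚ ≤ C
  0≤C = ≤-trans 0≤o (≤-trans (p≤p+q o 0≤o) o+o≤C)

  EmptyOrBig⇒≤C : ∀ {x} → EmptyOrBig o C x → x ≤ C
  EmptyOrBig⇒≤C (inj₁ refl)      = 0≤C
  EmptyOrBig⇒≤C (inj₂ (_ , x≤C)) = x≤C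

  place-big : ∀ {ℓ x} → EmptyOrBig o C ℓ → EmptyOrBig o C x → ℓ ≤ o → EmptyOrBig o C (ℓ + x)
  place-big {x = x} (inj₁ refl) x-ok _ = subst (EmptyOrBig o C) (sym (+-identityˡ x)) x-ok
  place-big (inj₂ (o<ℓ , _)) _ ℓ≤o = ⊥-elim (<-irrefl refl (<-≤-trans o<ℓ ℓ≤o))

  place-small : ∀ {ℓ x} → ℓ ≤ C → x ≤ o → ℓ ≤ o → ℓ + x ≤ C
  place-small _ x≤o ℓ≤o = ≤-trans (+-mono-≤ ℓ≤o x≤o) o+o≤C

  module Phase₁ = ListScheduling M o (EmptyOrBig o C) (EmptyOrBig o C) place-big
  module Phase₂ = ListScheduling M o (_≤ C) (_≤ o) place-small

  load-merge : ∀ τ₁ τ₂ c → load b (λ i → if isBig i then τ₁ i else τ₂ i) c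
                            ≡ (0ℚ + load big τ₁ c) + load small τ₂ c
  load-merge τ₁ τ₂ c =
    trans (load-if isBig b τ₁ τ₂ c) (cong (_+ load small τ₂ c) (sym (+-identityˡ (load big τ₁ c))))

  big-EmptyOrBig : ∀ i → EmptyOrBig o C (big i)
  big-EmptyOrBig i with o <? b i
  ... | yes o<b = inj₂ (o<b , b≤C i)
  ... | no _    = inj₁ refl

  small≤o : ∀ i → small i ≤ o
  small≤o i with o <? b i
  ... | yes _   = 0≤o
  ... | no o≮b = ≮⇒≥ o≮b

  0≤big : ∀ i → 0ℚ ≤ big i
  0≤big i with isBig i
  ... | true  = 0≤b i
  ... | false = ≤-refl

  0≤small : ∀ i → 0ℚ ≤ small i
  0≤small i with isBig i
  ... | true  = ≤-refl
  ... | false = 0≤b i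

  big≤b : ∀ i → big i ≤ b i
  big≤b i with isBig i
  ... | true  = ≤-refl
  ... | false = 0≤b i

  total₁ : sumFin K (λ _ → 0ℚ) + sumFin m big ≤ sumFin K (λ _ → o)
  total₁ = begin
    sumFin K (λ _ → 0ℚ) + sumFin m big ≡⟨ cong (_+ sumFin m big) (sumFin-zero K) ⟩
    0ℚ + sumFin m big                  ≡⟨ +-identityˡ _ ⟩
    sumFin m big                       ≤⟨ sumFin-mono-≤ m big≤b ⟩
    sumFin m b                         ≤⟨ total ⟩
    sumFin K (λ _ → o)                 ∎
    where open ≤-Reasoning

  total₂ : ∀ τ₁ → sumFin K (λ c → 0ℚ + load big τ₁ c) + sumFin m small ≤ sumFin K (λ _ → o)
  total₂ τ₁ = begin
    sumFin K (λ c → 0ℚ + load big τ₁ c) + sumFin m small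
      ≡⟨ cong (_+ sumFin m small) (sumFin-cong K (λ c → +-identityˡ (load big τ₁ c))) ⟩
    sumFin K (load big τ₁) + sumFin m small
      ≡⟨ cong (_+ sumFin m small) (sumFin-load big τ₁) ⟩
    sumFin m big + sumFin m small
      ≡⟨ sumFin-distrib-+ m big small ⟨
    sumFin m (λ i → big i + small i)
      ≡⟨ sumFin-cong m (λ i → if-split (isBig i) (b i)) ⟩
    sumFin m b
      ≤⟨ total ⟩
    sumFin K (λ _ → o) ∎
    where open ≤-Reasoning

lemma16 : ∀ (n m : ℕ) (p : Fin n → ℚ) → (∀ j → 0ℚ ≤ p j)
          → (bags : Fin n → Fin m)
          → (opt* : Fin n → Fin m) → (∀ (σ : Fin n → Fin m) → makespan p opt* ≤ makespan p σ)
          → (θ : ℚ) → makespan p bags ≤ θ * makespan p opt*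
          → ∀ (m₀ : ℕ) → 1 ≤ℕ m₀ → m₀ ≤ℕ m
          → ∀ (o : ℚ) → IsOpt p m₀ o
          → Σ (Fin m → Fin m₀) λ τ → makespan p (τ ∘ bags) ≤ (θ ⊔ two) * o
lemma16 n m p 0≤p bags opt* opt*-min θ bags≤θopt* (suc M) _ m₀≤m o ((σ , σ≡o) , _) =
  let τ , τ≤C = ∃-makespan-≤ M b 0≤o (p+p≤[q⊔two]*p θ 0≤o) (load-nonneg 0≤p bags) b≤C total
  in τ , subst (_≤ (θ ⊔ two) * o) (sym (makespan-∘ p bags τ)) τ≤C
  where
  b : Fin m → ℚ
  b = load p bags

  0≤o : 0ℚ ≤ o
  0≤o = subst (0ℚ ≤_) σ≡o (maxFin-nonneg (suc M) (load p σ))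

  opt*≤o : makespan p opt* ≤ o
  opt*≤o = ≤-trans (opt*-min (λ j → inject≤ (σ j) m₀≤m))
    (subst (makespan p (λ j → inject≤ (σ j) m₀≤m) ≤_) σ≡o
      (makespan-∘-injective p σ (inject≤-injective m₀≤m m₀≤m _ _)))

  b≤C : ∀ i → b i ≤ (θ ⊔ two) * o
  b≤C i = ≤-trans (≤-trans (f≤maxFin m b i) bags≤θopt*)
                  (q*p≤[q⊔two]*r θ (maxFin-nonneg m (load p opt*)) opt*≤o)

  total : sumFin m b ≤ sumFin (suc M) (λ _ → o)
  total = begin
    sumFin m b                            ≡⟨ sumFin-load p bags ⟩
    sumFin n p                            ≤⟨ sumFin≤sumFin-makespan p σ ⟩
    sumFin (suc M) (λ _ → makespan p σ)   ≡⟨ cong (λ x → sumFin (suc M) (λ _ → x)) σ≡o ⟩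
    sumFin (suc M) (λ _ → o)              ∎
    where open ≤-Reasoning
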